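{- For every integer $n\ge4$, $\varphi(C_n)=n-1$.
   Context: $C_n$ is the cycle on $n$ vertices. Two sets overlap if they intersect and neither is a subset of the other. An overlap representation of a graph $G=(V,E)$ is a family (multiset) of sets $\{S_v : v\in V\}$ such that for all $u,v\in V$, $(u,v)\in E$ iff $S_u\cap S_v\neq\emptyset$, $S_u\not\subseteq S_v$ and $S_v\not\subseteq S_u$; its size is $|\bigcup_{v} S_v|$, and the overlap number $\varphi(G)$ is the minimum size of an overlap representation of $G$. -}

module Defs where

open import Data.Nat using (ℕ; zero; suc; _≤_; _∸_)
open import Data.Fin using (Fin; toℕ)
open import Data.Fin.Subset using (Subset; _∩_; _⊆_; Nonempty; ⋃; ∣_∣)
open import Data.List using (List; tabulate)
open import Data.Product using (Σ; _×_)
open import Data.Sum using (_⊎_)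
open import Relation.Nullary using (¬_)
open import Relation.Binary.PropositionalEquality using (_≡_)
open import Function.Bundles using (_⇔_)

Graph : ℕ → Set₁
Graph n = Fin n → Fin n → Set

CycleStep : (n : ℕ) → Fin n → Fin n → Set
CycleStep n u v = (toℕ v ≡ suc (toℕ u)) ⊎ ((suc (toℕ u) ≡ n) × (toℕ v ≡ 0))

Cycle : (n : ℕ) → Graph n
Cycle n u v = CycleStep n u v ⊎ CycleStep n v u

Overlap : ∀ {k} → Subset k → Subset k → Set
Overlap A B = Nonempty (A ∩ B) × (¬ (A ⊆ B)) × (¬ (B ⊆ A))

IsOverlapRep : ∀ {n} → Graph n → (k : ℕ) → (Fin n → Subset k) → Set
IsOverlapRep {n} G k S = (u v : Fin n) → (G u v ⇔ Overlap (S u) (S v))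

repSize : ∀ {n k} → (Fin n → Subset k) → ℕ
repSize {n} S = ∣ ⋃ (tabulate S) ∣

OverlapNumberIs : ∀ {n} → Graph n → ℕ → Set
OverlapNumberIs {n} G m =
  (Σ ℕ λ k → Σ (Fin n → Subset k) λ S → IsOverlapRep G k S × repSize S ≡ m)
  × ((k : ℕ) (S : Fin n → Subset k) → IsOverlapRep G k S → m ≤ repSize S)

-- Upper bound: C_n is represented by intervals of {0, …, n-2}: a chain of unit
-- intervals, closed into a cycle by two long intervals.
-- Lower bound: deleting a vertex of C_n leaves an induced path on n-1 vertices,
-- and a path T_0, …, T_m (m ≥ 3) needs one element more than some path on m
-- vertices, while two overlapping sets already need three.  Orient the path so
-- that no T_j with j ≥ 2 lies inside T_0 (if some does, then so does T_m; so if
-- both orientations fail, T_0 ⊆ T_m ⊆ T_0, which would force T_1 ⊆ T_0).  Then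
-- every T_j with j ≥ 2 is disjoint from T_0 or contains it, so deleting a
-- well-chosen element of T_0 from T_1, …, T_m keeps them a path representation,
-- inside one element fewer.
module Submission where

open import Defs
open import Data.Nat using (ℕ; zero; suc; _+_; _≤_; _<_; _∸_; _≤′_; ≤′-refl; ≤′-step; z≤n; s≤s; _≤?_)
open import Data.Nat.Properties
  using ( ≤-refl; ≤-trans; ≤-antisym; ≤-total; <-cmp; <-irrefl; <-trans; <⇒≤; <⇒≱; ≰⇒>
        ; ≤-<-trans; ≤-pred; n≤1+n; n<1+n; m≤m+n; m≤n+m; m∸n≤m; n∸n≡0; +-∸-assoc; ∸-monoʳ-<
        ; suc-injective; ≤⇒≤′; ≤′⇒≤ )
open import Data.Fin using (Fin; zero; suc; toℕ; fromℕ<; _≟_)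
open import Data.Fin.Properties using (toℕ<n; toℕ-fromℕ<; any?)
open import Data.Fin.Subset
  using (Subset; inside; outside; _∈_; _∉_; _⊆_; _⊈_; _∩_; _─_; _-_; ⁅_⁆; ⋃; ∣_∣; Empty)
open import Data.Fin.Subset.Properties
  using ( _∈?_; _⊆?_; nonempty?; x∈p∩q⁺; x∈p∩q⁻; p─q⊆p; x∈⁅x⁆; x∈p∧x≢y⇒x∈p-y; x∈p⇒∣p-x∣<∣p∣
        ; p⊆p∪q; q⊆p∪q; ∣p∣≤n )
open import Data.List using (tabulate)
import Data.Vec as Vec
open import Data.Vec using (_∷_)
open import Data.Vec.Properties using (lookup∘tabulate; lookup⇒[]=; []=⇒lookup)
open import Data.Product using (_×_; _,_; proj₁; proj₂; ∃; ∃₂; swap; uncurry)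
import Data.Product as Product
open import Data.Sum using (_⊎_; inj₁; inj₂)
open import Data.Empty using (⊥-elim)
open import Function using (_∘_)
open import Function.Bundles using (_⇔_; mk⇔; Equivalence)
open import Relation.Nullary using (¬_; yes; no; does; contradiction)
open import Relation.Nullary.Decidable using (_×-dec_; ¬?; dec-true; decidable-stable)
open import Relation.Unary using (Decidable)
open import Relation.Binary using (tri<; tri≈; tri>)
open import Relation.Binary.PropositionalEquality
  using (_≡_; _≢_; refl; sym; trans; cong; subst; subst₂; ≢-sym)

open Equivalence using (to; from)

private
  variable
    k m l a b c d i j : ℕ
    x y z z' : Fin k
    A B C W : Subset k
    T : ℕ → Subset k

x∈p─q⇒x∉q : ∀ {p q : Subset k} → x ∈ p ─ q → x ∉ q
x∈p─q⇒x∉q {p = _ ∷ _} {inside  ∷ _} () Vec.here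
x∈p─q⇒x∉q {p = _ ∷ _} {outside ∷ _} Vec.here ()
x∈p─q⇒x∉q {p = _ ∷ _} {_       ∷ _} (Vec.there x∈p─q) (Vec.there x∈q) = x∈p─q⇒x∉q x∈p─q x∈q

x∈p-y⇒x∈p : x ∈ A - y → x ∈ A
x∈p-y⇒x∈p {A = A} {y = y} = p─q⊆p A ⁅ y ⁆

x∈p-y⇒x≢y : x ∈ A - y → x ≢ y
x∈p-y⇒x≢y x∈A-x refl = x∈p─q⇒x∉q x∈A-x (x∈⁅x⁆ _)

x∈p∧y∉p⇒x≢y : x ∈ A → y ∉ A → x ≢ y
x∈p∧y∉p⇒x≢y x∈A x∉A refl = x∉A x∈A

p⊆q⇒p-x⊆q-x : A ⊆ B → A - x ⊆ B - x
p⊆q⇒p-x⊆q-x A⊆B y∈A-x = x∈p∧x≢y⇒x∈p-y (A⊆B (x∈p-y⇒x∈p y∈A-x)) (x∈p-y⇒x≢y y∈A-x)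

⊈-witness : A ⊈ B → ∃ λ x → x ∈ A × x ∉ B
⊈-witness {A = A} {B = B} A⊈B with any? (λ x → x ∈? A ×-dec ¬? (x ∈? B))
... | yes witness = witness
... | no  ∄x      = ⊥-elim (A⊈B A⊆B)
  where
  A⊆B : A ⊆ B
  A⊆B {x} x∈A = decidable-stable (x ∈? B) (λ x∉B → ∄x (x , x∈A , x∉B))

-- Overlapping sets

overlap-sym : Overlap A B → Overlap B A
overlap-sym ((x , x∈A∩B) , A⊈B , B⊈A) = (x , x∈p∩q⁺ (swap (x∈p∩q⁻ _ _ x∈A∩B))) , B⊈A , A⊈B

overlap-witnesses : Overlap A B →
  (∃ λ w → w ∈ A × w ∈ B) × (∃ λ w → w ∈ A × w ∉ B) × (∃ λ w → w ∈ B × w ∉ A)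
overlap-witnesses ((u , u∈A∩B) , A⊈B , B⊈A) = (u , x∈p∩q⁻ _ _ u∈A∩B) , ⊈-witness A⊈B , ⊈-witness B⊈A

¬overlap⇒disjoint⊎⊆⊎⊇ : ¬ Overlap A B → Empty (A ∩ B) ⊎ A ⊆ B ⊎ B ⊆ A
¬overlap⇒disjoint⊎⊆⊎⊇ {A = A} {B = B} A≬̸B with nonempty? (A ∩ B) | A ⊆? B | B ⊆? A
... | no  A∩B=∅ | _         | _         = inj₁ A∩B=∅
... | yes _     | yes A⊆B   | _         = inj₂ (inj₁ A⊆B)
... | yes _     | no  _     | yes B⊆A   = inj₂ (inj₂ B⊆A)
... | yes A∩B≠∅ | no  A⊈B   | no  B⊈A   = contradiction (A∩B≠∅ , A⊈B , B⊈A) A≬̸B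

overlap∧⊆∧¬overlap⇒⊆ : Overlap A B → A ⊆ C → ¬ Overlap B C → B ⊆ C
overlap∧⊆∧¬overlap⇒⊆ ((x , x∈A∩B) , A⊈B , _) A⊆C B≬̸C with ¬overlap⇒disjoint⊎⊆⊎⊇ B≬̸C
... | inj₁ B∩C=∅      = ⊥-elim (B∩C=∅ (x , x∈p∩q⁺ (x∈B , A⊆C x∈A)))
  where
  x∈A = proj₁ (x∈p∩q⁻ _ _ x∈A∩B)
  x∈B = proj₂ (x∈p∩q⁻ _ _ x∈A∩B)
... | inj₂ (inj₁ B⊆C) = B⊆C
... | inj₂ (inj₂ C⊆B) = ⊥-elim (A⊈B (λ x∈A → C⊆B (A⊆C x∈A)))

overlap-minus⇒overlap : Overlap (A - z) (B - z) → Overlap A B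
overlap-minus⇒overlap ((x , x∈∩) , A-z⊈B-z , B-z⊈A-z) =
  (x , x∈p∩q⁺ (Product.map x∈p-y⇒x∈p x∈p-y⇒x∈p (x∈p∩q⁻ _ _ x∈∩))) ,
  (A-z⊈B-z ∘ p⊆q⇒p-x⊆q-x) , (B-z⊈A-z ∘ p⊆q⇒p-x⊆q-x)

overlap-minus⁺ :
  (∃ λ w → (w ∈ A × w ∈ B) × w ≢ z) → (∃ λ w → (w ∈ A × w ∉ B) × w ≢ z) →
  (∃ λ w → (w ∈ B × w ∉ A) × w ≢ z) → Overlap (A - z) (B - z)
overlap-minus⁺ (u , (u∈A , u∈B) , u≢z) (v , (v∈A , v∉B) , v≢z) (w , (w∈B , w∉A) , w≢z) =
  (u , x∈p∩q⁺ (x∈p∧x≢y⇒x∈p-y u∈A u≢z , x∈p∧x≢y⇒x∈p-y u∈B u≢z)) ,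
  (λ A-z⊆B-z → v∉B (x∈p-y⇒x∈p (A-z⊆B-z (x∈p∧x≢y⇒x∈p-y v∈A v≢z)))) ,
  (λ B-z⊆A-z → w∉A (x∈p-y⇒x∈p (B-z⊆A-z (x∈p∧x≢y⇒x∈p-y w∈B w≢z))))

overlap-minus-outside : z ∉ A → z ∉ B → Overlap A B → Overlap (A - z) (B - z)
overlap-minus-outside z∉A z∉B A≬B with overlap-witnesses A≬B
... | (u , u∈A , u∈B) , (v , v∈A , v∉B) , (w , w∈B , w∉A) =
  overlap-minus⁺ (u , (u∈A , u∈B) , x∈p∧y∉p⇒x≢y u∈A z∉A)
                 (v , (v∈A , v∉B) , x∈p∧y∉p⇒x≢y v∈A z∉A)
                 (w , (w∈B , w∉A) , x∈p∧y∉p⇒x≢y w∈B z∉B)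

-- A witness equal to z can be traded for its twin z'.
overlap-minus-twin : z' ≢ z → (z ∈ A ⇔ z' ∈ A) → (z ∈ B ⇔ z' ∈ B) →
                     Overlap A B → Overlap (A - z) (B - z)
overlap-minus-twin {z' = z'} {z = z} z'≢z A⇔ B⇔ A≬B with overlap-witnesses A≬B
... | A∩B , A─B , B─A =
  overlap-minus⁺ (avoid (Product.map (to A⇔) (to B⇔)) A∩B)
                 (avoid (Product.map (to A⇔) (λ z∉B → z∉B ∘ from B⇔)) A─B)
                 (avoid (Product.map (to B⇔) (λ z∉A → z∉A ∘ from A⇔)) B─A)
  where
  avoid : {P : Fin _ → Set} → (P z → P z') → ∃ P → ∃ λ w → P w × w ≢ z
  avoid P-transfer (w , Pw) with w ≟ z
  ... | yes refl = z' , P-transfer Pw , z'≢z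
  ... | no  w≢z  = w , Pw , w≢z

DoesNotSplit : Subset k → Subset k → Set
DoesNotSplit C A = A ⊆ C ⊎ Empty (A ∩ C)

doesNotSplit⇒⇔ : DoesNotSplit C A → z ∈ A → z' ∈ A → (z ∈ C ⇔ z' ∈ C)
doesNotSplit⇒⇔ (inj₁ A⊆C)   z∈A z'∈A = mk⇔ (λ _ → A⊆C z'∈A) (λ _ → A⊆C z∈A)
doesNotSplit⇒⇔ (inj₂ A∩C=∅) z∈A z'∈A =
  mk⇔ (λ z∈C → ⊥-elim (A∩C=∅ (_ , x∈p∩q⁺ (z∈A , z∈C))))
      (λ z'∈C → ⊥-elim (A∩C=∅ (_ , x∈p∩q⁺ (z'∈A , z'∈C))))

¬overlap⇒doesNotSplit : ¬ Overlap A C → C ⊈ A → DoesNotSplit C A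
¬overlap⇒doesNotSplit A≬̸C C⊈A with ¬overlap⇒disjoint⊎⊆⊎⊇ A≬̸C
... | inj₁ A∩C=∅      = inj₂ A∩C=∅
... | inj₂ (inj₁ A⊆C) = inj₁ A⊆C
... | inj₂ (inj₂ C⊆A) = ⊥-elim (C⊈A C⊆A)

-- With x ∈ A ─ B and y ∈ A ∩ B, delete x unless some element of C ─ A lies in
-- B, in which case delete y.
head-deletion : Overlap A B → Overlap B C → DoesNotSplit C A → C ⊈ A →
  ∃₂ λ z z' → z ∈ A × z' ∈ A × z' ≢ z × Overlap (B - z) (C - z)
head-deletion {A = A} {B = B} {C = C} A≬B B≬C A⊆C∨A∩C=∅ C⊈A with overlap-witnesses A≬B
... | (y , y∈A , y∈B) , (x , x∈A , x∉B) , _ = deletion A⊆C∨A∩C=∅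
  where
  y≢x : y ≢ x
  y≢x = x∈p∧y∉p⇒x≢y y∈B x∉B
  deletion : DoesNotSplit C A →
    ∃₂ λ z z' → z ∈ A × z' ∈ A × z' ≢ z × Overlap (B - z) (C - z)
  deletion (inj₂ A∩C=∅) =
    x , y , x∈A , y∈A , y≢x ,
    overlap-minus-outside x∉B (λ x∈C → A∩C=∅ (x , x∈p∩q⁺ (x∈A , x∈C))) B≬C
  deletion (inj₁ A⊆C) with ⊈-witness C⊈A | overlap-witnesses B≬C
  ... | e , e∈C , e∉A | (u , u∈B , u∈C) , (v , v∈B , v∉C) , (w , w∈C , w∉B) with e ∈? B
  ...   | no e∉B =
    x , y , x∈A , y∈A , y≢x ,
    overlap-minus⁺ (u , (u∈B , u∈C) , x∈p∧y∉p⇒x≢y u∈B x∉B)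
                   (v , (v∈B , v∉C) , x∈p∧y∉p⇒x≢y v∈B x∉B)
                   (e , (e∈C , e∉B) , ≢-sym (x∈p∧y∉p⇒x≢y x∈A e∉A))
  ...   | yes e∈B =
    y , x , y∈A , x∈A , ≢-sym y≢x ,
    overlap-minus⁺ (e , (e∈B , e∈C) , ≢-sym (x∈p∧y∉p⇒x≢y y∈A e∉A))
                   (v , (v∈B , v∉C) , ≢-sym (x∈p∧y∉p⇒x≢y (A⊆C y∈A) v∉C))
                   (w , (w∈C , w∉B) , ≢-sym (x∈p∧y∉p⇒x≢y y∈B w∉B))

overlap⇒3≤∣W∣ : Overlap A B → A ⊆ W → B ⊆ W → 3 ≤ ∣ W ∣
overlap⇒3≤∣W∣ A≬B A⊆W B⊆W with overlap-witnesses A≬B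
... | (u , u∈A , u∈B) , (v , v∈A , v∉B) , (w , w∈B , w∉A) =
  ≤-trans (s≤s (≤-trans (s≤s (≤-trans (s≤s z≤n) (x∈p⇒∣p-x∣<∣p∣ w∈W-u-v)))
                        (x∈p⇒∣p-x∣<∣p∣ v∈W-u)))
          (x∈p⇒∣p-x∣<∣p∣ (B⊆W u∈B))
  where
  v∈W-u = x∈p∧x≢y⇒x∈p-y (A⊆W v∈A) (≢-sym (x∈p∧y∉p⇒x≢y u∈B v∉B))
  w∈W-u-v = x∈p∧x≢y⇒x∈p-y (x∈p∧x≢y⇒x∈p-y (B⊆W w∈B) (≢-sym (x∈p∧y∉p⇒x≢y u∈A w∉A)))
                          (≢-sym (x∈p∧y∉p⇒x≢y v∈A w∉A))

-- Paths

-- The sets T i with i ≥ m are ignored; indexing by ℕ makes shifting and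
-- reversing paths easy.
record IsPathRep (m : ℕ) (T : ℕ → Subset k) : Set where
  field
    adjacent    : suc i < m → Overlap (T i) (T (suc i))
    nonadjacent : suc i < j → j < m → ¬ Overlap (T i) (T j)
open IsPathRep

Covers : ℕ → (ℕ → Subset k) → Subset k → Set
Covers m T W = ∀ {i} → i < m → T i ⊆ W

⊆-head-propagates : IsPathRep (suc m) T → 2 ≤ j → j ≤ m → T j ⊆ T 0 → T m ⊆ T 0
⊆-head-propagates {m = m} {T = T} {j = j} P 2≤j j≤m Tj⊆T0 = go (≤⇒≤′ j≤m) ≤-refl
  where
  go : ∀ {i} → j ≤′ i → i ≤ m → T i ⊆ T 0
  go ≤′-refl _ = Tj⊆T0
  go {suc i} (≤′-step j≤′i) si≤m =
    overlap∧⊆∧¬overlap⇒⊆ (adjacent P (s≤s si≤m)) (go j≤′i (<⇒≤ si≤m))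
      (nonadjacent P (≤-trans (≤-trans 2≤j (≤′⇒≤ j≤′i)) (n≤1+n i)) (s≤s si≤m) ∘ overlap-sym)

∸-suc : i < m → m ∸ i ≡ suc (m ∸ suc i)
∸-suc = +-∸-assoc 1

reverse : IsPathRep (suc m) T → IsPathRep (suc m) (λ i → T (m ∸ i))
reverse {m = m} {T = T} P = record { adjacent = adj ; nonadjacent = nonadj }
  where
  adj : suc i < suc m → Overlap (T (m ∸ i)) (T (m ∸ suc i))
  adj (s≤s si≤m) rewrite ∸-suc si≤m = overlap-sym (adjacent P (s≤s (∸-monoʳ-< (s≤s z≤n) si≤m)))
  nonadj : suc i < j → j < suc m → ¬ Overlap (T (m ∸ i)) (T (m ∸ j))
  nonadj {i} {j} si<j (s≤s j≤m) =
    nonadjacent P 1+m∸j<m∸i (s≤s (m∸n≤m m i)) ∘ overlap-sym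
    where
    1+m∸j<m∸i : suc (m ∸ j) < m ∸ i
    1+m∸j<m∸i rewrite ∸-suc (≤-trans (<⇒≤ si<j) j≤m) = s≤s (∸-monoʳ-< si<j j≤m)

reverse-covers : Covers (suc m) T W → Covers (suc m) (λ i → T (m ∸ i)) W
reverse-covers {m = m} cover {i} _ = cover (s≤s (m∸n≤m m i))

head-doesNotSplit : IsPathRep (suc m) T → 2 ≤ j → j ≤ m → T j ⊈ T 0 → DoesNotSplit (T j) (T 0)
head-doesNotSplit P 2≤j j≤m = ¬overlap⇒doesNotSplit (nonadjacent P 2≤j (s≤s j≤m))

shrink-front : 2 ≤ m → IsPathRep (suc m) T → (∀ {j} → 2 ≤ j → j ≤ m → T j ⊈ T 0) →
  Covers (suc m) T W → ∃₂ λ z T′ → z ∈ W × IsPathRep m T′ × Covers m T′ (W - z)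
shrink-front {m = m} {T = T} 2≤m P T⊈T0 cover
  with head-deletion (adjacent P (≤-trans 2≤m (n≤1+n m))) (adjacent P (s≤s 2≤m))
                     (head-doesNotSplit P ≤-refl 2≤m (T⊈T0 ≤-refl 2≤m)) (T⊈T0 ≤-refl 2≤m)
... | z , z' , z∈T0 , z'∈T0 , z'≢z , T1-z≬T2-z =
  z , (λ i → T (suc i) - z) , cover (s≤s z≤n) z∈T0 , P′ , (λ i<m → p⊆q⇒p-x⊆q-x (cover (s≤s i<m)))
  where
  twin : 2 ≤ j → j ≤ m → (z ∈ T j ⇔ z' ∈ T j)
  twin 2≤j j≤m = doesNotSplit⇒⇔ (head-doesNotSplit P 2≤j j≤m (T⊈T0 2≤j j≤m)) z∈T0 z'∈T0
  P′ : IsPathRep m (λ i → T (suc i) - z)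
  adjacent P′ {zero} _ = T1-z≬T2-z
  adjacent P′ {suc i} 3+i≤m =
    overlap-minus-twin z'≢z (twin (s≤s (s≤s z≤n)) (<⇒≤ 3+i≤m)) (twin (s≤s (s≤s z≤n)) 3+i≤m)
      (adjacent P (s≤s 3+i≤m))
  nonadjacent P′ si<j j<m = nonadjacent P (s≤s si<j) (s≤s j<m) ∘ overlap-minus⇒overlap

shrink : 3 ≤ m → IsPathRep (suc m) T → Covers (suc m) T W →
  ∃₂ λ z T′ → z ∈ W × IsPathRep m T′ × Covers m T′ (W - z)
shrink {m = m} {T = T} 3≤m P cover with T m ⊆? T 0
... | no Tm⊈T0 =
  shrink-front (<⇒≤ 3≤m) P (λ 2≤j j≤m → Tm⊈T0 ∘ ⊆-head-propagates P 2≤j j≤m) cover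
... | yes Tm⊆T0 = shrink-front (<⇒≤ 3≤m) (reverse P) reversed-head (reverse-covers cover)
  where
  reversed-head : 2 ≤ j → j ≤ m → T (m ∸ j) ⊈ T m
  reversed-head 2≤j j≤m Tm∸j⊆Tm = proj₂ (proj₂ T0≬T1) (Tm⊆T0 ∘ T1⊆Tm)
    where
    T0≬T1 = adjacent P (≤-trans (<⇒≤ 3≤m) (n≤1+n m))
    T0⊆Tm : T 0 ⊆ T m
    T0⊆Tm = subst (λ i → T i ⊆ T m) (n∸n≡0 m) (⊆-head-propagates (reverse P) 2≤j j≤m Tm∸j⊆Tm)
    T1⊆Tm = overlap∧⊆∧¬overlap⇒⊆ T0≬T1 T0⊆Tm (nonadjacent P 3≤m ≤-refl)

pathRep-size : 3 ≤ m → IsPathRep m T → Covers m T W → m ≤ ∣ W ∣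
pathRep-size 3≤m = go (≤⇒≤′ 3≤m)
  where
  go : ∀ {m T W} → 3 ≤′ m → IsPathRep {k} m T → Covers m T W → m ≤ ∣ W ∣
  go ≤′-refl P cover =
    overlap⇒3≤∣W∣ (adjacent P (s≤s (s≤s z≤n))) (cover (s≤s z≤n)) (cover (s≤s (s≤s z≤n)))
  go (≤′-step 3≤′m) P cover with shrink (≤′⇒≤ 3≤′m) P cover
  ... | _ , _ , z∈W , P′ , cover′ = ≤-<-trans (go 3≤′m P′ cover′) (x∈p⇒∣p-x∣<∣p∣ z∈W)

-- Cycles

-- Cycle n u v unfolds to CycleAdj n (toℕ u) (toℕ v).
CycleSucc : ℕ → ℕ → ℕ → Set
CycleSucc n a b = (b ≡ suc a) ⊎ ((suc a ≡ n) × (b ≡ 0))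

CycleAdj : ℕ → ℕ → ℕ → Set
CycleAdj n a b = CycleSucc n a b ⊎ CycleSucc n b a

cycleAdj-sym : ∀ {n} → CycleAdj n a b → CycleAdj n b a
cycleAdj-sym (inj₁ a→b) = inj₂ a→b
cycleAdj-sym (inj₂ b→a) = inj₁ b→a

¬cycleAdj : suc i < j → j < m → ¬ CycleAdj (suc m) i j
¬cycleAdj si<j _   (inj₁ (inj₁ refl))           = <-irrefl refl si<j
¬cycleAdj ()   _   (inj₁ (inj₂ (_ , refl)))
¬cycleAdj si<j _   (inj₂ (inj₁ refl))           = <⇒≱ si<j (m≤n+m _ 2)
¬cycleAdj _    j<m (inj₂ (inj₂ (1+j≡1+m , _))) = <-irrefl (suc-injective 1+j≡1+m) j<m

clamp : ℕ → Fin (suc m)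
clamp zero = zero
clamp {zero}  (suc i) = zero
clamp {suc m} (suc i) = suc (clamp i)

toℕ-clamp : i ≤ m → toℕ (clamp {m} i) ≡ i
toℕ-clamp {zero}  z≤n     = refl
toℕ-clamp {suc i} (s≤s i≤m) = cong suc (toℕ-clamp i≤m)

⊆⋃-tabulate : ∀ {n} (S : Fin n → Subset k) v → S v ⊆ ⋃ (tabulate S)
⊆⋃-tabulate S zero    x∈ = p⊆p∪q _ x∈
⊆⋃-tabulate S (suc v) x∈ = q⊆p∪q (S zero) _ (⊆⋃-tabulate (S ∘ suc) v x∈)

cycle⇒path : {S : Fin (suc m) → Subset k} →
             IsOverlapRep (Cycle (suc m)) k S → IsPathRep m (S ∘ clamp)
cycle⇒path {m = m} {S = S} rep = record { adjacent = adj ; nonadjacent = nonadj }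
  where
  adj : suc i < m → Overlap (S (clamp i)) (S (clamp (suc i)))
  adj {i} si<m = to (rep (clamp i) (clamp (suc i))) (inj₁ (inj₁
    (trans (toℕ-clamp (<⇒≤ si<m)) (cong suc (sym (toℕ-clamp (≤-trans (n≤1+n i) (<⇒≤ si<m))))))))
  nonadj : suc i < j → j < m → ¬ Overlap (S (clamp i)) (S (clamp j))
  nonadj {i} {j} si<j j<m Si≬Sj = ¬cycleAdj si<j j<m
    (subst₂ (CycleAdj (suc m)) (toℕ-clamp (<⇒≤ (<-trans i<j j<m))) (toℕ-clamp (<⇒≤ j<m))
            (from (rep (clamp i) (clamp j)) Si≬Sj))
    where
    i<j = <-trans (n<1+n i) si<j

cycleRep-size : {S : Fin (suc m) → Subset k} →
                3 ≤ m → IsOverlapRep (Cycle (suc m)) k S → m ≤ repSize S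
cycleRep-size {S = S} 3≤m rep = pathRep-size 3≤m (cycle⇒path rep) (λ _ → ⊆⋃-tabulate S (clamp _))

-- Intervals

select : {P : Fin k → Set} → Decidable P → Subset k
select P? = Vec.tabulate (does ∘ P?)

∈-select⁺ : {P : Fin k → Set} (P? : Decidable P) → P x → x ∈ select P?
∈-select⁺ {x = x} P? Px =
  lookup⇒[]= x _ (trans (lookup∘tabulate (does ∘ P?) x) (dec-true (P? x) Px))

∈-select⁻ : {P : Fin k → Set} (P? : Decidable P) → x ∈ select P? → P x
∈-select⁻ {x = x} P? x∈ with P? x | trans (sym (lookup∘tabulate (does ∘ P?) x)) ([]=⇒lookup x∈)
... | yes Px | _  = Px
... | no  _  | ()

between? : (a b : ℕ) → Decidable (λ (x : Fin k) → a ≤ toℕ x × toℕ x ≤ b)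
between? a b x = a ≤? toℕ x ×-dec toℕ x ≤? b

interval : ℕ → ℕ → Subset k
interval a b = select (between? a b)

∈-interval⁺ : a ≤ toℕ x → toℕ x ≤ b → x ∈ interval a b
∈-interval⁺ {a = a} {b = b} a≤x x≤b = ∈-select⁺ (between? a b) (a≤x , x≤b)

∈-interval⁻ : ∀ a b → x ∈ interval a b → a ≤ toℕ x × toℕ x ≤ b
∈-interval⁻ a b = ∈-select⁻ (between? a b)

fromℕ<∈interval⁺ : (c<k : c < k) → a ≤ c → c ≤ b → fromℕ< c<k ∈ interval a b
fromℕ<∈interval⁺ {a = a} {b = b} c<k =
  subst (λ t → a ≤ t → t ≤ b → fromℕ< c<k ∈ interval a b) (toℕ-fromℕ< c<k) ∈-interval⁺

fromℕ<∈interval⁻ : ∀ a b (c<k : c < k) → fromℕ< c<k ∈ interval a b → a ≤ c × c ≤ b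
fromℕ<∈interval⁻ a b c<k = subst (λ t → a ≤ t × t ≤ b) (toℕ-fromℕ< c<k) ∘ ∈-interval⁻ a b

interval-mono : c ≤ a → b ≤ d → interval {k} a b ⊆ interval c d
interval-mono {a = a} {b = b} c≤a b≤d x∈ with ∈-interval⁻ a b x∈
... | a≤x , x≤b = ∈-interval⁺ (≤-trans c≤a a≤x) (≤-trans x≤b b≤d)

Interleaved : ℕ × ℕ → ℕ × ℕ → Set
Interleaved (a , b) (c , d) = (a < c × c ≤ b × b < d) ⊎ (c < a × a ≤ d × d < b)

interleaved-sym : ∀ {I J} → Interleaved I J → Interleaved J I
interleaved-sym (inj₁ ι) = inj₂ ι
interleaved-sym (inj₂ ι) = inj₁ ι

crossing⇒overlap : b < k → d < k → a < c → c ≤ b → b < d → Overlap (interval a b) (interval c d)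
crossing⇒overlap {b = b} {d = d} {a = a} {c = c} b<k d<k a<c c≤b b<d =
  (fromℕ< c<k , x∈p∩q⁺ ( fromℕ<∈interval⁺ c<k (<⇒≤ a<c) c≤b
                       , fromℕ<∈interval⁺ c<k ≤-refl (≤-trans c≤b (<⇒≤ b<d)))) ,
  (λ ab⊆cd → <⇒≱ a<c (proj₁ (fromℕ<∈interval⁻ c d a<k (ab⊆cd (fromℕ<∈interval⁺ a<k ≤-refl a≤b))))) ,
  (λ cd⊆ab → <⇒≱ b<d (proj₂ (fromℕ<∈interval⁻ a b d<k (cd⊆ab (fromℕ<∈interval⁺ d<k c≤d ≤-refl)))))
  where
  c<k = ≤-<-trans c≤b b<k
  a≤b = ≤-trans (<⇒≤ a<c) c≤b
  a<k = ≤-<-trans a≤b b<k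
  c≤d = ≤-trans c≤b (<⇒≤ b<d)

interleaved⇒overlap : b < k → d < k → Interleaved (a , b) (c , d) →
                      Overlap (interval a b) (interval c d)
interleaved⇒overlap b<k d<k (inj₁ (a<c , c≤b , b<d)) = crossing⇒overlap b<k d<k a<c c≤b b<d
interleaved⇒overlap b<k d<k (inj₂ (c<a , a≤d , d<b)) =
  overlap-sym (crossing⇒overlap d<k b<k c<a a≤d d<b)

overlap⇒crossing : a < c → Overlap (interval {k} a b) (interval c d) → c ≤ b × b < d
overlap⇒crossing {a = a} {c = c} {b = b} {d = d} a<c ((x , x∈∩) , _ , cd⊈ab)
  with x∈p∩q⁻ _ _ x∈∩
... | x∈ab , x∈cd =
  ≤-trans (proj₁ (∈-interval⁻ c d x∈cd)) (proj₂ (∈-interval⁻ a b x∈ab)) ,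
  ≰⇒> (λ d≤b → cd⊈ab (interval-mono (<⇒≤ a<c) d≤b))

overlap⇒interleaved : Overlap (interval {k} a b) (interval c d) → Interleaved (a , b) (c , d)
overlap⇒interleaved {a = a} {c = c} ab≬cd with <-cmp a c
... | tri< a<c _ _ = inj₁ (a<c , overlap⇒crossing a<c ab≬cd)
... | tri> _ _ c<a = inj₂ (c<a , overlap⇒crossing c<a (overlap-sym ab≬cd))
overlap⇒interleaved {a = a} {b = b} {d = d} (_ , ab⊈ad , ad⊈ab) | tri≈ _ refl _ with ≤-total b d
... | inj₁ b≤d = ⊥-elim (ab⊈ad (interval-mono (≤-refl {a}) b≤d))
... | inj₂ d≤b = ⊥-elim (ad⊈ab (interval-mono (≤-refl {a}) d≤b))

-- The vertices 2, …, l+2 of C_(3+l) form a chain of unit intervals; [1,l+1]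
-- and [0,l] cross each other and contain all of the chain except the unit
-- interval next to them.
cycleInterval : ℕ → ℕ → ℕ × ℕ
cycleInterval l zero          = 0 , l
cycleInterval l (suc zero)    = 1 , suc l
cycleInterval l (suc (suc v)) = v , suc v

cycleIntervals : (l : ℕ) → Fin (3 + l) → Subset (2 + l)
cycleIntervals l v = uncurry interval (cycleInterval l (toℕ v))

cycleInterval-right< : a < 3 + l → proj₂ (cycleInterval l a) < 2 + l
cycleInterval-right< {a = zero}        _   = s≤s (n≤1+n _)
cycleInterval-right< {a = suc zero}    _   = ≤-refl
cycleInterval-right< {a = suc (suc a)} a<n = ≤-pred a<n

cycleSucc⇒interleaved : 1 ≤ l → CycleSucc (3 + l) a b →
                        Interleaved (cycleInterval l a) (cycleInterval l b)
cycleSucc⇒interleaved {a = zero}        1≤l (inj₁ refl) = inj₁ (s≤s z≤n , 1≤l , n<1+n _)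
cycleSucc⇒interleaved {a = suc zero}    1≤l (inj₁ refl) = inj₂ (s≤s z≤n , ≤-refl , s≤s 1≤l)
cycleSucc⇒interleaved {a = suc (suc a)} _   (inj₁ refl) = inj₁ (n<1+n a , ≤-refl , n<1+n (suc a))
cycleSucc⇒interleaved {l = l}           1≤l (inj₂ (refl , refl)) = inj₂ (1≤l , ≤-refl , n<1+n l)

cycleAdj⇒interleaved : 1 ≤ l → CycleAdj (3 + l) a b →
                       Interleaved (cycleInterval l a) (cycleInterval l b)
cycleAdj⇒interleaved 1≤l (inj₁ a→b) = cycleSucc⇒interleaved 1≤l a→b
cycleAdj⇒interleaved 1≤l (inj₂ b→a) = interleaved-sym (cycleSucc⇒interleaved 1≤l b→a)

longInterleaved⇒cycleAdj : a ≤ 1 → b < 3 + l →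
  Interleaved (cycleInterval l a) (cycleInterval l b) → CycleAdj (3 + l) a b
longInterleaved⇒cycleAdj {b = zero}          z≤n _ (inj₁ (() , _))
longInterleaved⇒cycleAdj {b = zero}          z≤n _ (inj₂ (() , _))
longInterleaved⇒cycleAdj {b = suc zero}      z≤n _ _ = inj₁ (inj₁ refl)
longInterleaved⇒cycleAdj {b = suc (suc b)}   z≤n _ (inj₁ (_ , b≤l , l<1+b))
  with ≤-antisym b≤l (≤-pred l<1+b)
... | refl = inj₂ (inj₂ (refl , refl))
longInterleaved⇒cycleAdj {b = suc (suc b)}   z≤n _ (inj₂ (() , _))
longInterleaved⇒cycleAdj {b = zero}          (s≤s z≤n) _ _ = inj₂ (inj₁ refl)
longInterleaved⇒cycleAdj {b = suc zero}      (s≤s z≤n) _ (inj₁ (s≤s () , _))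
longInterleaved⇒cycleAdj {b = suc zero}      (s≤s z≤n) _ (inj₂ (s≤s () , _))
longInterleaved⇒cycleAdj {b = suc (suc b)}   (s≤s z≤n) b<n (inj₁ (_ , _ , 1+l<1+b)) =
  contradiction (≤-pred (≤-pred (≤-pred b<n))) (<⇒≱ (≤-pred 1+l<1+b))
longInterleaved⇒cycleAdj {b = suc (suc zero)} (s≤s z≤n) _ (inj₂ _) = inj₁ (inj₁ refl)
longInterleaved⇒cycleAdj {b = suc (suc (suc b))} (s≤s z≤n) _ (inj₂ (s≤s () , _))

interleaved⇒cycleAdj : a < 3 + l → b < 3 + l →
  Interleaved (cycleInterval l a) (cycleInterval l b) → CycleAdj (3 + l) a b
interleaved⇒cycleAdj {a = zero}     _ b<n = longInterleaved⇒cycleAdj z≤n b<n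
interleaved⇒cycleAdj {a = suc zero} _ b<n = longInterleaved⇒cycleAdj (s≤s z≤n) b<n
interleaved⇒cycleAdj {a = suc (suc _)} {b = zero} a<n _ =
  cycleAdj-sym ∘ longInterleaved⇒cycleAdj z≤n a<n ∘ interleaved-sym
interleaved⇒cycleAdj {a = suc (suc _)} {b = suc zero} a<n _ =
  cycleAdj-sym ∘ longInterleaved⇒cycleAdj (s≤s z≤n) a<n ∘ interleaved-sym
interleaved⇒cycleAdj {a = suc (suc a)} {b = suc (suc b)} _ _ (inj₁ (a<b , b≤1+a , _))
  with ≤-antisym b≤1+a a<b
... | refl = inj₁ (inj₁ refl)
interleaved⇒cycleAdj {a = suc (suc a)} {b = suc (suc b)} _ _ (inj₂ (b<a , a≤1+b , _))
  with ≤-antisym a≤1+b b<a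
... | refl = inj₂ (inj₁ refl)

cycleIntervals-rep : 1 ≤ l → IsOverlapRep (Cycle (3 + l)) (2 + l) (cycleIntervals l)
cycleIntervals-rep 1≤l u v = mk⇔
  (interleaved⇒overlap (cycleInterval-right< (toℕ<n u)) (cycleInterval-right< (toℕ<n v))
    ∘ cycleAdj⇒interleaved 1≤l)
  (interleaved⇒cycleAdj (toℕ<n u) (toℕ<n v) ∘ overlap⇒interleaved)

corollary15 : (n : ℕ) → 4 ≤ n → OverlapNumberIs (Cycle n) (n ∸ 1)
corollary15 _ (s≤s (s≤s (s≤s (s≤s {n = d} z≤n)))) =
  (3 + d , S , rep , ≤-antisym (∣p∣≤n (⋃ (tabulate S))) (cycleRep-size 3≤3+d rep)) ,
  λ _ _ → cycleRep-size 3≤3+d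
  where
  S = cycleIntervals (suc d)
  rep = cycleIntervals-rep {l = suc d} (s≤s z≤n)
  3≤3+d = m≤m+n 3 d
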